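{- Let $a,b,c,d\in\mathbb{C}$ with $a+b+c+d=1$ and $a+b,a+c,a+d\notin\{0,-1,-2,\ldots\}$, and let $x\in\mathbb{C}$. Then for every $n\ge0$, $$\sum_{k=0}^n\frac{(-n)_k}{(1+n)_k(a+b)_k(a+c)_k(a+d)_k}W_k(x^2;a,b,c,d)=\frac{n!\,(a+ix)_n(a-ix)_n+(a+b)_n(a+c)_n(a+d)_n}{2(a+b)_n(a+c)_n(a+d)_n}.$$
   Context: Rising factorial: $(\gamma)_0=1$, $(\gamma)_k=\gamma(\gamma+1)\cdots(\gamma+k-1)$. The Wilson polynomials are $W_n(x^2;a,b,c,d)=(a+b)_n(a+c)_n(a+d)_n\sum_{j=0}^n\frac{(-n)_j(n+a+b+c+d-1)_j(a+ix)_j(a-ix)_j}{j!\,(a+b)_j(a+c)_j(a+d)_j}$ (a terminating ${}_4F_3(1)$ series). -}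

module Defs where

open import Level using (Level; _⊔_) renaming (suc to lsuc)
open import Data.Nat using (ℕ; zero; suc; _!)
open import Relation.Nullary using (¬_)
open import Algebra.Bundles using (CommutativeRing)

ιR : {c ℓ : Level} (R : CommutativeRing c ℓ) → ℕ → CommutativeRing.Carrier R
ιR R zero    = CommutativeRing.0# R
ιR R (suc n) = CommutativeRing._+_ R (CommutativeRing.1# R) (ιR R n)

-- A field of characteristic 0 containing a square root of -1 (abstracting ℂ).
-- The inverse is a total function, specified only on nonzero elements.
record ComplexLikeField (c ℓ : Level) : Set (lsuc (c ⊔ ℓ)) where
  field
    cring : CommutativeRing c ℓ
  open CommutativeRing cring public

  field
    _⁻¹      : Carrier → Carrier
    ⁻¹-inverse : ∀ x → ¬ (x ≈ 0#) → x * (x ⁻¹) ≈ 1#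
    char0    : ∀ n → ¬ (ιR cring (suc n) ≈ 0#)
    i        : Carrier
    i*i≈-1   : i * i ≈ - 1#

module _ {c ℓ : Level} (F : ComplexLikeField c ℓ) where
  open ComplexLikeField F hiding (zero)

  ι : ℕ → ComplexLikeField.Carrier F
  ι = ιR cring

  poch : Carrier → ℕ → Carrier
  poch γ zero    = 1#
  poch γ (suc k) = poch γ k * (γ + ι k)

  sumTo : ℕ → (ℕ → Carrier) → Carrier
  sumTo zero    f = f zero
  sumTo (suc n) f = sumTo n f + f (suc n)

  W : ℕ → (x a b c d : Carrier) → Carrier
  W n x a b c d =
    (poch (a + b) n * poch (a + c) n * poch (a + d) n) *
    sumTo n (λ j →
      (poch (- ι n) j * poch (ι n + a + b + c + d - 1#) j
        * poch (a + i * x) j * poch (a - i * x) j)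
      * (ι (j !) * poch (a + b) j * poch (a + c) j * poch (a + d) j) ⁻¹)

-- Since a + b + c + d = 1, Wₖ = Aₖ ∑_{j≤k} (-k)ⱼ (k)ⱼ uⱼ with Aₖ = (a+b)ₖ (a+c)ₖ (a+d)ₖ and
-- uⱼ = (a+ix)ⱼ (a-ix)ⱼ / (j! Aⱼ). Exchanging the two sums turns the left-hand side into
-- ∑_{j≤n} uⱼ H n j, where H n j = ∑_{k≤n} (-n)ₖ/(n+1)ₖ · (-k)ⱼ (k)ⱼ is free of the parameters.
-- The ratio (-n)ₖ/(n+1)ₖ telescopes, giving H n 0 = 1/2 for n ≥ 1, and the recurrence
-- H (n+1) (j+1) = (n+1)² H n j + (j² - (n+1)²) H (n+1) j then yields H n j = 0 for 0 < j < n
-- and H n n = (n!)²/2. Hence the sum equals (1 + (n!)² uₙ)/2.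
module Submission where

open import Defs
open import Level using (Level)
open import Algebra.Bundles using (CommutativeRing)
open import Data.Nat as ℕ using (ℕ; zero; suc; _!; _≤_; _<_; _≤′_; z≤n; s≤s; ≤′-step; ≤′-reflexive)
import Data.Nat.Properties as ℕ
open import Data.Integer as ℤ using (ℤ; +_; -[1+_])
import Data.Integer.Properties as ℤ
open import Data.Maybe using (Maybe; just; nothing)
import Data.Sign as Sign
open import Relation.Nullary using (¬_; yes; no)
import Relation.Binary.PropositionalEquality as ≡
import Algebra.Solver.Ring.AlmostCommutativeRing as ACR

-- The standard library instantiates Algebra.Solver.Ring only with ℕ coefficients or with
-- coefficients having decidable equality; here the coefficients are integers, mapped into R.
module IntegerCoefficientSolver {c ℓ : Level} (R : CommutativeRing c ℓ) where
  open CommutativeRing R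
  open import Algebra.Properties.Ring ring using (-‿distribˡ-*; -‿distribʳ-*)
  open import Algebra.Properties.Group +-group using (ε⁻¹≈ε; ⁻¹-involutive)
  open import Algebra.Properties.AbelianGroup +-abelianGroup using (⁻¹-∙-comm)
  open import Algebra.Properties.Semiring.Mult.TCOptimised semiring
  open import Relation.Binary.Reasoning.Setoid setoid

  -- The optimised multiplication makes 1 × 1# definitionally 1#, so that the solver
  -- constant con (+ 1) denotes 1# itself.
  fromℤ : ℤ → Carrier
  fromℤ (+ n)    = n × 1#
  fromℤ -[1+ n ] = - (suc n × 1#)

  private
    [x+y]-[x+z]≈y-z : ∀ x y z → (x + y) - (x + z) ≈ y - z
    [x+y]-[x+z]≈y-z x y z = begin
      (x + y) - (x + z)      ≈⟨ +-cong (+-comm y x) (⁻¹-∙-comm x z) ⟨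
      (y + x) + (- x - z)    ≈⟨ +-assoc y x (- x - z) ⟩
      y + (x + (- x - z))    ≈⟨ +-congˡ (+-assoc x (- x) (- z)) ⟨
      y + ((x - x) - z)      ≈⟨ +-congˡ (+-congʳ (-‿inverseʳ x)) ⟩
      y + (0# - z)           ≈⟨ +-congˡ (+-identityˡ (- z)) ⟩
      y - z                  ∎

    fromℤ-⊖ : ∀ m n → fromℤ (m ℤ.⊖ n) ≈ m × 1# - n × 1#
    fromℤ-⊖ zero    zero    = sym (-‿inverseʳ 0#)
    fromℤ-⊖ zero    (suc n) = sym (+-identityˡ _)
    fromℤ-⊖ (suc m) zero    = sym (trans (+-congˡ ε⁻¹≈ε) (+-identityʳ _))
    fromℤ-⊖ (suc m) (suc n) = begin
      fromℤ (suc m ℤ.⊖ suc n)         ≡⟨ ≡.cong fromℤ (ℤ.[1+m]⊖[1+n]≡m⊖n m n) ⟩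
      fromℤ (m ℤ.⊖ n)                 ≈⟨ fromℤ-⊖ m n ⟩
      m × 1# - n × 1#                 ≈⟨ [x+y]-[x+z]≈y-z 1# (m × 1#) (n × 1#) ⟨
      (1# + m × 1#) - (1# + n × 1#)   ≈⟨ +-cong (1+× m 1#) (-‿cong (1+× n 1#)) ⟨
      suc m × 1# - suc n × 1#         ∎

    fromℤ-pos◃ : ∀ n → fromℤ (Sign.+ ℤ.◃ n) ≈ n × 1#
    fromℤ-pos◃ zero    = refl
    fromℤ-pos◃ (suc n) = refl

    fromℤ-neg◃ : ∀ n → fromℤ (Sign.- ℤ.◃ n) ≈ - (n × 1#)
    fromℤ-neg◃ zero    = sym ε⁻¹≈ε
    fromℤ-neg◃ (suc n) = refl

    fromℤ-+ : ∀ i j → fromℤ (i ℤ.+ j) ≈ fromℤ i + fromℤ j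
    fromℤ-+ (+ m)    (+ n)    = ×-homo-+ 1# m n
    fromℤ-+ (+ m)    -[1+ n ] = fromℤ-⊖ m (suc n)
    fromℤ-+ -[1+ m ] (+ n)    = trans (fromℤ-⊖ n (suc m)) (+-comm _ _)
    fromℤ-+ -[1+ m ] -[1+ n ] = begin
      - (suc (suc (m ℕ.+ n)) × 1#)      ≡⟨ ≡.cong (λ k → - (suc k × 1#)) (ℕ.+-suc m n) ⟨
      - ((suc m ℕ.+ suc n) × 1#)        ≈⟨ -‿cong (×-homo-+ 1# (suc m) (suc n)) ⟩
      - (suc m × 1# + suc n × 1#)       ≈⟨ ⁻¹-∙-comm _ _ ⟨
      - (suc m × 1#) + - (suc n × 1#)   ∎

    fromℤ-* : ∀ i j → fromℤ (i ℤ.* j) ≈ fromℤ i * fromℤ j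
    fromℤ-* (+ m)    (+ n)    = trans (fromℤ-pos◃ (m ℕ.* n)) (×1-homo-* m n)
    fromℤ-* (+ m)    -[1+ n ] = begin
      fromℤ (Sign.- ℤ.◃ (m ℕ.* suc n))  ≈⟨ fromℤ-neg◃ (m ℕ.* suc n) ⟩
      - ((m ℕ.* suc n) × 1#)            ≈⟨ -‿cong (×1-homo-* m (suc n)) ⟩
      - (m × 1# * suc n × 1#)           ≈⟨ -‿distribʳ-* _ _ ⟩
      m × 1# * - (suc n × 1#)           ∎
    fromℤ-* -[1+ m ] (+ n)    = begin
      fromℤ (Sign.- ℤ.◃ (suc m ℕ.* n))  ≈⟨ fromℤ-neg◃ (suc m ℕ.* n) ⟩
      - ((suc m ℕ.* n) × 1#)            ≈⟨ -‿cong (×1-homo-* (suc m) n) ⟩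
      - (suc m × 1# * n × 1#)           ≈⟨ -‿distribˡ-* _ _ ⟩
      - (suc m × 1#) * n × 1#           ∎
    fromℤ-* -[1+ m ] -[1+ n ] = begin
      (suc m ℕ.* suc n) × 1#            ≈⟨ ×1-homo-* (suc m) (suc n) ⟩
      suc m × 1# * suc n × 1#           ≈⟨ ⁻¹-involutive _ ⟨
      - - (suc m × 1# * suc n × 1#)     ≈⟨ -‿cong (-‿distribˡ-* _ _) ⟩
      - (- (suc m × 1#) * suc n × 1#)   ≈⟨ -‿distribʳ-* _ _ ⟩
      - (suc m × 1#) * - (suc n × 1#)   ∎

    fromℤ-neg : ∀ i → fromℤ (ℤ.- i) ≈ - fromℤ i
    fromℤ-neg (+ zero)  = sym ε⁻¹≈ε
    fromℤ-neg (+ suc n) = refl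
    fromℤ-neg -[1+ n ]  = sym (⁻¹-involutive _)

    fromℤ-homomorphism : ℤ.+-*-rawRing ACR.-Raw-AlmostCommutative⟶ ACR.fromCommutativeRing R
    fromℤ-homomorphism = record
      { ⟦_⟧    = fromℤ
      ; +-homo = fromℤ-+
      ; *-homo = fromℤ-*
      ; -‿homo = fromℤ-neg
      ; 0-homo = refl
      ; 1-homo = refl
      }

    fromℤ-≟ : ∀ i j → Maybe (fromℤ i ≈ fromℤ j)
    fromℤ-≟ i j with i ℤ.≟ j
    ... | yes ≡.refl = just refl
    ... | no _       = nothing

  open import Algebra.Solver.Ring ℤ.+-*-rawRing (ACR.fromCommutativeRing R) fromℤ-homomorphism fromℤ-≟ public

module WilsonSum {f ℓ : Level} (F : ComplexLikeField f ℓ) where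
  open ComplexLikeField F hiding (zero)
  open IntegerCoefficientSolver cring using (solve; _:=_; con; _:+_; _:*_; _:-_; :-_)
  open import Algebra.Properties.CommutativeSemigroup *-commutativeSemigroup
    using () renaming (interchange to *-interchange)
  open import Algebra.Properties.CommutativeSemigroup +-commutativeSemigroup
    using () renaming (interchange to +-interchange)
  open import Relation.Binary.Reasoning.Setoid setoid

  NonZero : Carrier → Set ℓ
  NonZero x = ¬ (x ≈ 0#)

  ⁻¹-inverseˡ : ∀ {x} → NonZero x → x ⁻¹ * x ≈ 1#
  ⁻¹-inverseˡ {x} x≉0 = trans (*-comm (x ⁻¹) x) (⁻¹-inverse x x≉0)

  *-cancelˡ : ∀ {x y z} → NonZero x → x * y ≈ x * z → y ≈ z
  *-cancelˡ {x} {y} {z} x≉0 xy≈xz = begin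
    y                ≈⟨ *-identityˡ y ⟨
    1# * y           ≈⟨ *-congʳ (⁻¹-inverseˡ x≉0) ⟨
    (x ⁻¹ * x) * y   ≈⟨ *-assoc _ _ _ ⟩
    x ⁻¹ * (x * y)   ≈⟨ *-congˡ xy≈xz ⟩
    x ⁻¹ * (x * z)   ≈⟨ *-assoc _ _ _ ⟨
    (x ⁻¹ * x) * z   ≈⟨ *-congʳ (⁻¹-inverseˡ x≉0) ⟩
    1# * z           ≈⟨ *-identityˡ z ⟩
    z                ∎

  *-nonZero : ∀ {x y} → NonZero x → NonZero y → NonZero (x * y)
  *-nonZero {x} {y} x≉0 y≉0 xy≈0 = y≉0 (*-cancelˡ x≉0 (trans xy≈0 (sym (zeroʳ x))))

  ⁻¹-unique : ∀ {x y} → NonZero x → x * y ≈ 1# → x ⁻¹ ≈ y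
  ⁻¹-unique {x} x≉0 xy≈1 = *-cancelˡ x≉0 (trans (⁻¹-inverse x x≉0) (sym xy≈1))

  ≉0-resp-≈ : ∀ {x y} → x ≈ y → NonZero x → NonZero y
  ≉0-resp-≈ x≈y x≉0 y≈0 = x≉0 (trans x≈y y≈0)

  ⁻¹-cong : ∀ {x y} → NonZero y → x ≈ y → x ⁻¹ ≈ y ⁻¹
  ⁻¹-cong {y = y} y≉0 x≈y =
    ⁻¹-unique (≉0-resp-≈ (sym x≈y) y≉0) (trans (*-congʳ x≈y) (⁻¹-inverse y y≉0))

  ⁻¹-distrib-* : ∀ {x y} → NonZero x → NonZero y → (x * y) ⁻¹ ≈ x ⁻¹ * y ⁻¹
  ⁻¹-distrib-* {x} {y} x≉0 y≉0 = ⁻¹-unique (*-nonZero x≉0 y≉0) (begin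
    (x * y) * (x ⁻¹ * y ⁻¹)   ≈⟨ *-interchange x y (x ⁻¹) (y ⁻¹) ⟩
    (x * x ⁻¹) * (y * y ⁻¹)   ≈⟨ *-cong (⁻¹-inverse x x≉0) (⁻¹-inverse y y≉0) ⟩
    1# * 1#                   ≈⟨ *-identityˡ 1# ⟩
    1#                        ∎)

  x*y≈z⇒y≈z*x⁻¹ : ∀ {x y z} → NonZero x → x * y ≈ z → y ≈ z * x ⁻¹
  x*y≈z⇒y≈z*x⁻¹ {x} {y} {z} x≉0 xy≈z = *-cancelˡ x≉0 (begin
    x * y             ≈⟨ xy≈z ⟩
    z                 ≈⟨ *-identityʳ z ⟨
    z * 1#            ≈⟨ *-congˡ (⁻¹-inverse x x≉0) ⟨
    z * (x * x ⁻¹)    ≈⟨ *-assoc z x (x ⁻¹) ⟨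
    z * x * x ⁻¹      ≈⟨ *-congʳ (*-comm z x) ⟩
    x * z * x ⁻¹      ≈⟨ *-assoc x z (x ⁻¹) ⟩
    x * (z * x ⁻¹)    ∎)

  x*[a*y+b*z]≈a*[x*y]+b*[x*z] : ∀ x a b y z → x * (a * y + b * z) ≈ a * (x * y) + b * (x * z)
  x*[a*y+b*z]≈a*[x*y]+b*[x*z] = solve 5 (λ x a b y z → x :* (a :* y :+ b :* z) := a :* (x :* y) :+ b :* (x :* z)) refl

  1≉0 : NonZero 1#
  1≉0 1≈0 = char0 0 (trans (+-identityʳ 1#) 1≈0)

  1⁻¹≈1 : 1# ⁻¹ ≈ 1#
  1⁻¹≈1 = ⁻¹-unique 1≉0 (*-identityˡ 1#)

  ⟦_⟧ : ℕ → Carrier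
  ⟦_⟧ = ι F

  ⟦+⟧ : ∀ m n → ⟦ m ℕ.+ n ⟧ ≈ ⟦ m ⟧ + ⟦ n ⟧
  ⟦+⟧ zero    n = sym (+-identityˡ ⟦ n ⟧)
  ⟦+⟧ (suc m) n = trans (+-congˡ (⟦+⟧ m n)) (sym (+-assoc 1# ⟦ m ⟧ ⟦ n ⟧))

  ⟦*⟧ : ∀ m n → ⟦ m ℕ.* n ⟧ ≈ ⟦ m ⟧ * ⟦ n ⟧
  ⟦*⟧ zero    n = sym (zeroˡ ⟦ n ⟧)
  ⟦*⟧ (suc m) n = begin
    ⟦ n ℕ.+ m ℕ.* n ⟧         ≈⟨ ⟦+⟧ n (m ℕ.* n) ⟩
    ⟦ n ⟧ + ⟦ m ℕ.* n ⟧       ≈⟨ +-cong (*-identityˡ ⟦ n ⟧) (sym (⟦*⟧ m n)) ⟨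
    1# * ⟦ n ⟧ + ⟦ m ⟧ * ⟦ n ⟧ ≈⟨ distribʳ ⟦ n ⟧ 1# ⟦ m ⟧ ⟨
    (1# + ⟦ m ⟧) * ⟦ n ⟧      ∎

  ⟦⟧-nonZero : ∀ n → .{{ℕ.NonZero n}} → NonZero ⟦ n ⟧
  ⟦⟧-nonZero (suc n) = char0 n

  1+⟦m⟧+⟦n⟧-nonZero : ∀ m n → NonZero (1# + ⟦ m ⟧ + ⟦ n ⟧)
  1+⟦m⟧+⟦n⟧-nonZero m n =
    ≉0-resp-≈ (trans (+-congˡ (⟦+⟧ m n)) (sym (+-assoc 1# ⟦ m ⟧ ⟦ n ⟧))) (⟦⟧-nonZero (suc (m ℕ.+ n)))

  two≉0 : NonZero (1# + 1#)
  two≉0 = ≉0-resp-≈ (+-congˡ (+-identityʳ 1#)) (⟦⟧-nonZero 2)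

  ∑ : ℕ → (ℕ → Carrier) → Carrier
  ∑ = sumTo F

  ∑-cong : ∀ n {f g : ℕ → Carrier} → (∀ k → k ≤ n → f k ≈ g k) → ∑ n f ≈ ∑ n g
  ∑-cong zero    f≈g = f≈g 0 z≤n
  ∑-cong (suc n) f≈g = +-cong (∑-cong n (λ k k≤n → f≈g k (ℕ.m≤n⇒m≤1+n k≤n))) (f≈g (suc n) ℕ.≤-refl)

  ∑-distrib-+ : ∀ n (f g : ℕ → Carrier) → ∑ n (λ k → f k + g k) ≈ ∑ n f + ∑ n g
  ∑-distrib-+ zero    f g = refl
  ∑-distrib-+ (suc n) f g =
    trans (+-congʳ (∑-distrib-+ n f g)) (+-interchange (∑ n f) (∑ n g) (f (suc n)) (g (suc n)))

  *-distribˡ-∑ : ∀ n x (f : ℕ → Carrier) → x * ∑ n f ≈ ∑ n (λ k → x * f k)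
  *-distribˡ-∑ zero    x f = refl
  *-distribˡ-∑ (suc n) x f = trans (distribˡ x (∑ n f) (f (suc n))) (+-congʳ (*-distribˡ-∑ n x f))

  ∑-comm : ∀ m n (f : ℕ → ℕ → Carrier) → ∑ m (λ k → ∑ n (f k)) ≈ ∑ n (λ j → ∑ m (λ k → f k j))
  ∑-comm zero    n f = refl
  ∑-comm (suc m) n f =
    trans (+-congʳ (∑-comm m n f)) (sym (∑-distrib-+ n (λ j → ∑ m (λ k → f k j)) (f (suc m))))

  ∑-suc : ∀ n (f : ℕ → Carrier) → ∑ (suc n) f ≈ f 0 + ∑ n (λ k → f (suc k))
  ∑-suc zero    f = refl
  ∑-suc (suc n) f = trans (+-congʳ (∑-suc n f)) (+-assoc _ _ _)

  ∑-telescope : ∀ n (g : ℕ → Carrier) → ∑ n (λ k → g k - g (suc k)) ≈ g 0 - g (suc n)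
  ∑-telescope zero    g = refl
  ∑-telescope (suc n) g = begin
    ∑ n (λ k → g k - g (suc k)) + (g (suc n) - g (suc (suc n)))
      ≈⟨ +-congʳ (∑-telescope n g) ⟩
    (g 0 - g (suc n)) + (g (suc n) - g (suc (suc n)))
      ≈⟨ solve 3 (λ x y z → (x :- y) :+ (y :- z) := x :- z) refl (g 0) (g (suc n)) (g (suc (suc n))) ⟩
    g 0 - g (suc (suc n)) ∎

  ∑-extend : ∀ {m n} (f : ℕ → Carrier) → m ≤′ n → (∀ k → m < k → f k ≈ 0#) → ∑ n f ≈ ∑ m f
  ∑-extend f (≤′-reflexive ≡.refl) f≈0 = refl
  ∑-extend f (≤′-step {n} m≤′n)     f≈0 = begin
    ∑ n f + f (suc n)  ≈⟨ +-cong (∑-extend f m≤′n f≈0) (f≈0 (suc n) (s≤s (ℕ.≤′⇒≤ m≤′n))) ⟩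
    _ + 0#             ≈⟨ +-identityʳ _ ⟩
    _                  ∎

  ∑-last : ∀ n (f : ℕ → Carrier) → (∀ k → k < n → f k ≈ 0#) → ∑ n f ≈ f n
  ∑-last zero    f f≈0 = refl
  ∑-last (suc n) f f≈0 = begin
    ∑ n f + f (suc n)
      ≈⟨ +-congʳ (trans (∑-last n f (λ k k<n → f≈0 k (ℕ.m<n⇒m<1+n k<n))) (f≈0 n ℕ.≤-refl)) ⟩
    0# + f (suc n)     ≈⟨ +-identityˡ _ ⟩
    f (suc n)          ∎

  infixl 8 _↑_
  _↑_ : Carrier → ℕ → Carrier
  _↑_ = poch F

  ↑-congˡ : ∀ {γ δ} → γ ≈ δ → ∀ k → γ ↑ k ≈ δ ↑ k
  ↑-congˡ γ≈δ zero    = refl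
  ↑-congˡ γ≈δ (suc k) = *-cong (↑-congˡ γ≈δ k) (+-congʳ γ≈δ)

  ↑-nonZero : ∀ {γ} → (∀ t → NonZero (γ + ⟦ t ⟧)) → ∀ k → NonZero (γ ↑ k)
  ↑-nonZero γ+t≉0 zero    = 1≉0
  ↑-nonZero γ+t≉0 (suc k) = *-nonZero (↑-nonZero γ+t≉0 k) (γ+t≉0 k)

  -⟦n⟧↑k≈0 : ∀ n {k} → n < k → (- ⟦ n ⟧) ↑ k ≈ 0#
  -⟦n⟧↑k≈0 n (s≤s n≤k) = vanishes (ℕ.≤⇒≤′ n≤k)
    where
    vanishes : ∀ {k} → n ≤′ k → (- ⟦ n ⟧) ↑ suc k ≈ 0#
    vanishes (≤′-reflexive ≡.refl) = trans (*-congˡ (-‿inverseˡ ⟦ n ⟧)) (zeroʳ _)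
    vanishes (≤′-step n≤′k)         = trans (*-congʳ (vanishes n≤′k)) (zeroˡ _)

  ρ : ℕ → ℕ → Carrier
  ρ n k = (- ⟦ n ⟧) ↑ k * ((1# + ⟦ n ⟧) ↑ k) ⁻¹

  ρ-zeroʳ : ∀ n → ρ n 0 ≈ 1#
  ρ-zeroʳ n = trans (*-congˡ 1⁻¹≈1) (*-identityˡ 1#)

  ρ-vanishes : ∀ n → ρ n (suc n) ≈ 0#
  ρ-vanishes n = trans (*-congʳ (-⟦n⟧↑k≈0 n ℕ.≤-refl)) (zeroˡ _)

  ρ-sucʳ : ∀ n k → (1# + ⟦ n ⟧ + ⟦ k ⟧) * ρ n (suc k) ≈ (⟦ k ⟧ - ⟦ n ⟧) * ρ n k
  ρ-sucʳ n k = begin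
    s * ((P * (- ⟦ n ⟧ + ⟦ k ⟧)) * (B * s) ⁻¹)
      ≈⟨ *-congˡ (*-congˡ (⁻¹-distrib-* (↑-nonZero (1+⟦m⟧+⟦n⟧-nonZero n) k) (1+⟦m⟧+⟦n⟧-nonZero n k))) ⟩
    s * ((P * (- ⟦ n ⟧ + ⟦ k ⟧)) * (B ⁻¹ * s ⁻¹))
      ≈⟨ regroup s P ⟦ n ⟧ ⟦ k ⟧ (B ⁻¹) (s ⁻¹) ⟩
    (s * s ⁻¹) * ((⟦ k ⟧ - ⟦ n ⟧) * ρ n k)
      ≈⟨ *-congʳ (⁻¹-inverse s (1+⟦m⟧+⟦n⟧-nonZero n k)) ⟩
    1# * ((⟦ k ⟧ - ⟦ n ⟧) * ρ n k)
      ≈⟨ *-identityˡ _ ⟩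
    (⟦ k ⟧ - ⟦ n ⟧) * ρ n k ∎
    where
    s P B : Carrier
    s = 1# + ⟦ n ⟧ + ⟦ k ⟧
    P = (- ⟦ n ⟧) ↑ k
    B = (1# + ⟦ n ⟧) ↑ k
    regroup : ∀ s P m k B⁻¹ s⁻¹ → s * ((P * (- m + k)) * (B⁻¹ * s⁻¹)) ≈ (s * s⁻¹) * ((k - m) * (P * B⁻¹))
    regroup = solve 6 (λ s P m k B⁻¹ s⁻¹ →
      s :* ((P :* (:- m :+ k)) :* (B⁻¹ :* s⁻¹)) := (s :* s⁻¹) :* ((k :- m) :* (P :* B⁻¹))) refl

  ρ-sucˡ : ∀ n k → ρ (suc n) k * (⟦ suc n ⟧ * ⟦ suc n ⟧ - ⟦ k ⟧ * ⟦ k ⟧)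
                   ≈ ⟦ suc n ⟧ * ⟦ suc n ⟧ * ρ n k
  ρ-sucˡ n zero = begin
    ρ (suc n) 0 * (N * N - 0# * 0#)  ≈⟨ *-congʳ (ρ-zeroʳ (suc n)) ⟩
    1# * (N * N - 0# * 0#)
      ≈⟨ solve 1 (λ N → con (+ 1) :* (N :* N :- con (+ 0) :* con (+ 0)) := N :* N :* con (+ 1)) refl N ⟩
    N * N * 1#                       ≈⟨ *-congˡ (ρ-zeroʳ n) ⟨
    N * N * ρ n 0                    ∎
    where
    N : Carrier
    N = ⟦ suc n ⟧
  ρ-sucˡ n (suc k) = *-cancelˡ (*-nonZero (1+⟦m⟧+⟦n⟧-nonZero n k) (1+⟦m⟧+⟦n⟧-nonZero (suc n) k)) (begin
    (s₀ * s₁) * (ρ (suc n) (suc k) * (N * N - K′ * K′))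
      ≈⟨ regroupˡ s₀ s₁ (ρ (suc n) (suc k)) (N * N - K′ * K′) ⟩
    s₀ * (s₁ * ρ (suc n) (suc k)) * (N * N - K′ * K′)
      ≈⟨ *-congʳ (*-congˡ (ρ-sucʳ (suc n) k)) ⟩
    s₀ * ((⟦ k ⟧ - N) * ρ (suc n) k) * (N * N - K′ * K′)
      ≈⟨ factors ⟦ n ⟧ ⟦ k ⟧ (ρ (suc n) k) ⟩
    s₁ * (⟦ k ⟧ - ⟦ n ⟧) * (ρ (suc n) k * (N * N - ⟦ k ⟧ * ⟦ k ⟧))
      ≈⟨ *-congˡ (ρ-sucˡ n k) ⟩
    s₁ * (⟦ k ⟧ - ⟦ n ⟧) * (N * N * ρ n k)
      ≈⟨ regroupʳ s₁ (⟦ k ⟧ - ⟦ n ⟧) (N * N) (ρ n k) ⟩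
    s₁ * (N * N) * ((⟦ k ⟧ - ⟦ n ⟧) * ρ n k)
      ≈⟨ *-congˡ (ρ-sucʳ n k) ⟨
    s₁ * (N * N) * (s₀ * ρ n (suc k))
      ≈⟨ regroupʳ s₁ (N * N) s₀ (ρ n (suc k)) ⟩
    s₁ * s₀ * (N * N * ρ n (suc k))
      ≈⟨ *-congʳ (*-comm s₁ s₀) ⟩
    (s₀ * s₁) * (N * N * ρ n (suc k)) ∎)
    where
    N K′ s₀ s₁ : Carrier
    N = ⟦ suc n ⟧
    K′ = ⟦ suc k ⟧
    s₀ = 1# + ⟦ n ⟧ + ⟦ k ⟧
    s₁ = 1# + N + ⟦ k ⟧
    regroupˡ : ∀ a b r d → (a * b) * (r * d) ≈ a * (b * r) * d
    regroupˡ = solve 4 (λ a b r d → (a :* b) :* (r :* d) := a :* (b :* r) :* d) refl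
    regroupʳ : ∀ a b c′ d → a * b * (c′ * d) ≈ a * c′ * (b * d)
    regroupʳ = solve 4 (λ a b c′ d → a :* b :* (c′ :* d) := a :* c′ :* (b :* d)) refl
    factors : ∀ m k r →
      (1# + m + k) * ((k - (1# + m)) * r) * ((1# + m) * (1# + m) - (1# + k) * (1# + k))
        ≈ (1# + (1# + m) + k) * (k - m) * (r * ((1# + m) * (1# + m) - k * k))
    factors = solve 3 (λ m k r →
      (con (+ 1) :+ m :+ k) :* ((k :- (con (+ 1) :+ m)) :* r)
        :* ((con (+ 1) :+ m) :* (con (+ 1) :+ m) :- (con (+ 1) :+ k) :* (con (+ 1) :+ k))
      := (con (+ 1) :+ (con (+ 1) :+ m) :+ k) :* (k :- m) :* (r :* ((con (+ 1) :+ m) :* (con (+ 1) :+ m) :- k :* k))) refl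

  ρ-telescopes : ∀ n k → (⟦ n ⟧ + ⟦ n ⟧) * ρ n k
                         ≈ (⟦ n ⟧ + ⟦ k ⟧) * ρ n k - (⟦ n ⟧ + ⟦ suc k ⟧) * ρ n (suc k)
  ρ-telescopes n k = begin
    (m + m) * ρ n k                                ≈⟨ difference m ⟦ k ⟧ (ρ n k) ⟩
    (m + ⟦ k ⟧) * ρ n k - (⟦ k ⟧ - m) * ρ n k      ≈⟨ +-congˡ (-‿cong (ρ-sucʳ n k)) ⟨
    (m + ⟦ k ⟧) * ρ n k - (1# + m + ⟦ k ⟧) * ρ n (suc k)
      ≈⟨ +-congˡ (-‿cong (*-congʳ (trans (+-congʳ (+-comm 1# m)) (+-assoc m 1# ⟦ k ⟧)))) ⟩
    (m + ⟦ k ⟧) * ρ n k - (m + ⟦ suc k ⟧) * ρ n (suc k) ∎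
    where
    m : Carrier
    m = ⟦ n ⟧
    difference : ∀ m k r → (m + m) * r ≈ (m + k) * r - (k - m) * r
    difference = solve 3 (λ m k r → (m :+ m) :* r := (m :+ k) :* r :- (k :- m) :* r) refl

  two-∑ρ : ∀ n → (1# + 1#) * ∑ (suc n) (ρ (suc n)) ≈ 1#
  two-∑ρ n = *-cancelˡ (⟦⟧-nonZero (suc n)) (begin
    m * ((1# + 1#) * ∑ (suc n) (ρ (suc n)))        ≈⟨ double m (∑ (suc n) (ρ (suc n))) ⟩
    (m + m) * ∑ (suc n) (ρ (suc n))                ≈⟨ *-distribˡ-∑ (suc n) (m + m) (ρ (suc n)) ⟩
    ∑ (suc n) (λ k → (m + m) * ρ (suc n) k)        ≈⟨ ∑-cong (suc n) (λ k _ → ρ-telescopes (suc n) k) ⟩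
    ∑ (suc n) (λ k → T k - T (suc k))              ≈⟨ ∑-telescope (suc n) T ⟩
    T 0 - T (suc (suc n))
      ≈⟨ +-cong (*-congˡ (ρ-zeroʳ (suc n))) (-‿cong (*-congˡ (ρ-vanishes (suc n)))) ⟩
    (m + 0#) * 1# - (m + ⟦ suc (suc n) ⟧) * 0#     ≈⟨ boundary m (m + ⟦ suc (suc n) ⟧) ⟩
    m * 1#                                         ∎)
    where
    m : Carrier
    m = ⟦ suc n ⟧
    T : ℕ → Carrier
    T k = (m + ⟦ k ⟧) * ρ (suc n) k
    double : ∀ m x → m * ((1# + 1#) * x) ≈ (m + m) * x
    double = solve 2 (λ m x → m :* ((con (+ 1) :+ con (+ 1)) :* x) := (m :+ m) :* x) refl
    boundary : ∀ m y → (m + 0#) * 1# - y * 0# ≈ m * 1#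
    boundary = solve 2 (λ m y → (m :+ con (+ 0)) :* con (+ 1) :- y :* con (+ 0) := m :* con (+ 1)) refl

  -- (-k)ⱼ (k)ⱼ is the factor (-k)ⱼ (k + a + b + c + d - 1)ⱼ of Wₖ once a + b + c + d = 1.
  q : ℕ → ℕ → Carrier
  q k j = (- ⟦ k ⟧) ↑ j * ⟦ k ⟧ ↑ j

  q-zeroʳ : ∀ k → q k 0 ≈ 1#
  q-zeroʳ k = *-identityˡ 1#

  q-sucʳ : ∀ k j → q k (suc j) ≈ q k j * (⟦ j ⟧ * ⟦ j ⟧ - ⟦ k ⟧ * ⟦ k ⟧)
  q-sucʳ k j = regroup ((- ⟦ k ⟧) ↑ j) (⟦ k ⟧ ↑ j) ⟦ k ⟧ ⟦ j ⟧
    where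
    regroup : ∀ x y k j → (x * (- k + j)) * (y * (k + j)) ≈ (x * y) * (j * j - k * k)
    regroup = solve 4 (λ x y k j → (x :* (:- k :+ j)) :* (y :* (k :+ j)) := (x :* y) :* (j :* j :- k :* k)) refl

  q-vanishes : ∀ k j → k < j → q k j ≈ 0#
  q-vanishes k j k<j = trans (*-congʳ (-⟦n⟧↑k≈0 k k<j)) (zeroˡ _)

  H : ℕ → ℕ → Carrier
  H n j = ∑ n (λ k → ρ n k * q k j)

  H-zeroʳ : ∀ n → H n 0 ≈ ∑ n (ρ n)
  H-zeroʳ n = ∑-cong n (λ k _ → trans (*-congˡ (q-zeroʳ k)) (*-identityʳ (ρ n k)))

  H-zero-zero : H 0 0 ≈ 1#
  H-zero-zero = trans (H-zeroʳ 0) (ρ-zeroʳ 0)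

  two-H-zeroʳ : ∀ n → (1# + 1#) * H (suc n) 0 ≈ 1#
  two-H-zeroʳ n = trans (*-congˡ (H-zeroʳ (suc n))) (two-∑ρ n)

  H-suc : ∀ n j → H (suc n) (suc j)
                  ≈ ⟦ suc n ⟧ * ⟦ suc n ⟧ * H n j + (⟦ j ⟧ * ⟦ j ⟧ - ⟦ suc n ⟧ * ⟦ suc n ⟧) * H (suc n) j
  H-suc n j = begin
    ∑ (suc n) (λ k → ρ (suc n) k * q k (suc j))
      ≈⟨ ∑-cong (suc n) (λ k _ → split k) ⟩
    ∑ (suc n) (λ k → E * (ρ (suc n) k * q k j) + NN * (ρ n k * q k j))
      ≈⟨ ∑-distrib-+ (suc n) _ _ ⟩
    ∑ (suc n) (λ k → E * (ρ (suc n) k * q k j)) + ∑ (suc n) (λ k → NN * (ρ n k * q k j))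
      ≈⟨ +-cong (*-distribˡ-∑ (suc n) E _) (*-distribˡ-∑ (suc n) NN _) ⟨
    E * H (suc n) j + NN * (H n j + ρ n (suc n) * q (suc n) j)
      ≈⟨ +-congˡ (*-congˡ (+-congˡ (trans (*-congʳ (ρ-vanishes n)) (zeroˡ _)))) ⟩
    E * H (suc n) j + NN * (H n j + 0#)
      ≈⟨ trans (+-comm _ _) (+-congʳ (*-congˡ (+-identityʳ (H n j)))) ⟩
    NN * H n j + E * H (suc n) j ∎
    where
    NN E : Carrier
    NN = ⟦ suc n ⟧ * ⟦ suc n ⟧
    E = ⟦ j ⟧ * ⟦ j ⟧ - NN
    rearrange : ∀ r x j² k² N² → r * (x * (j² - k²)) ≈ (j² - N²) * (r * x) + x * (r * (N² - k²))
    rearrange = solve 5 (λ r x j² k² N² →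
      r :* (x :* (j² :- k²)) := (j² :- N²) :* (r :* x) :+ x :* (r :* (N² :- k²))) refl
    split : ∀ k → ρ (suc n) k * q k (suc j) ≈ E * (ρ (suc n) k * q k j) + NN * (ρ n k * q k j)
    split k = begin
      ρ (suc n) k * q k (suc j)
        ≈⟨ *-congˡ (q-sucʳ k j) ⟩
      ρ (suc n) k * (q k j * (⟦ j ⟧ * ⟦ j ⟧ - ⟦ k ⟧ * ⟦ k ⟧))
        ≈⟨ rearrange (ρ (suc n) k) (q k j) (⟦ j ⟧ * ⟦ j ⟧) (⟦ k ⟧ * ⟦ k ⟧) NN ⟩
      E * (ρ (suc n) k * q k j) + q k j * (ρ (suc n) k * (NN - ⟦ k ⟧ * ⟦ k ⟧))
        ≈⟨ +-congˡ (*-congˡ (ρ-sucˡ n k)) ⟩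
      E * (ρ (suc n) k * q k j) + q k j * (NN * ρ n k)
        ≈⟨ +-congˡ (trans (*-comm _ _) (*-assoc NN (ρ n k) (q k j))) ⟩
      E * (ρ (suc n) k * q k j) + NN * (ρ n k * q k j) ∎

  H-vanishes : ∀ j n → j < n → H (suc n) (suc j) ≈ 0#
  H-vanishes zero (suc n) _ = begin
    H (suc (suc n)) 1                                      ≈⟨ H-suc (suc n) 0 ⟩
    N * N * H (suc n) 0 + (0# * 0# - N * N) * H (suc (suc n)) 0
      ≈⟨ +-congˡ (*-congˡ (*-cancelˡ two≉0 (trans (two-H-zeroʳ (suc n)) (sym (two-H-zeroʳ n))))) ⟩
    N * N * H (suc n) 0 + (0# * 0# - N * N) * H (suc n) 0  ≈⟨ cancel (N * N) (H (suc n) 0) ⟩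
    0#                                                     ∎
    where
    N : Carrier
    N = ⟦ suc (suc n) ⟧
    cancel : ∀ x h → x * h + (0# * 0# - x) * h ≈ 0#
    cancel = solve 2 (λ x h → x :* h :+ (con (+ 0) :* con (+ 0) :- x) :* h := con (+ 0)) refl
  H-vanishes (suc j) (suc n) (s≤s j<n) = begin
    H (suc (suc n)) (suc (suc j))
      ≈⟨ H-suc (suc n) (suc j) ⟩
    N * N * H (suc n) (suc j) + (⟦ suc j ⟧ * ⟦ suc j ⟧ - N * N) * H (suc (suc n)) (suc j)
      ≈⟨ +-cong (*-congˡ (H-vanishes j n j<n)) (*-congˡ (H-vanishes j (suc n) (ℕ.m<n⇒m<1+n j<n))) ⟩
    N * N * 0# + (⟦ suc j ⟧ * ⟦ suc j ⟧ - N * N) * 0#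
      ≈⟨ trans (+-cong (zeroʳ _) (zeroʳ _)) (+-identityʳ 0#) ⟩
    0# ∎
    where
    N : Carrier
    N = ⟦ suc (suc n) ⟧

  two-H-diagonal : ∀ n → (1# + 1#) * H (suc n) (suc n) ≈ ⟦ suc n ! ⟧ * ⟦ suc n ! ⟧
  two-H-diagonal zero = begin
    (1# + 1#) * H 1 1                                      ≈⟨ *-congˡ (H-suc 0 0) ⟩
    (1# + 1#) * (N * N * H 0 0 + (0# * 0# - N * N) * H 1 0)
      ≈⟨ x*[a*y+b*z]≈a*[x*y]+b*[x*z] (1# + 1#) (N * N) (0# * 0# - N * N) (H 0 0) (H 1 0) ⟩
    N * N * ((1# + 1#) * H 0 0) + (0# * 0# - N * N) * ((1# + 1#) * H 1 0)
      ≈⟨ +-cong (*-congˡ (*-congˡ H-zero-zero)) (*-congˡ (two-H-zeroʳ 0)) ⟩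
    N * N * ((1# + 1#) * 1#) + (0# * 0# - N * N) * 1#      ≈⟨ simplify (N * N) ⟩
    N * N                                                  ∎
    where
    N : Carrier
    N = ⟦ 1 ⟧
    simplify : ∀ x → x * ((1# + 1#) * 1#) + (0# * 0# - x) * 1# ≈ x
    simplify = solve 1 (λ x →
      x :* ((con (+ 1) :+ con (+ 1)) :* con (+ 1)) :+ (con (+ 0) :* con (+ 0) :- x) :* con (+ 1) := x) refl
  two-H-diagonal (suc n) = begin
    (1# + 1#) * H (suc (suc n)) (suc (suc n))
      ≈⟨ *-congˡ (H-suc (suc n) (suc n)) ⟩
    (1# + 1#) * (N * N * H (suc n) (suc n) + E * H (suc (suc n)) (suc n))
      ≈⟨ x*[a*y+b*z]≈a*[x*y]+b*[x*z] (1# + 1#) (N * N) E (H (suc n) (suc n)) (H (suc (suc n)) (suc n)) ⟩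
    N * N * ((1# + 1#) * H (suc n) (suc n)) + E * ((1# + 1#) * H (suc (suc n)) (suc n))
      ≈⟨ +-cong (*-congˡ (two-H-diagonal n)) (*-congˡ (*-congˡ (H-vanishes n (suc n) ℕ.≤-refl))) ⟩
    N * N * (M * M) + E * ((1# + 1#) * 0#)
      ≈⟨ simplify N M E ⟩
    (N * M) * (N * M)
      ≈⟨ *-cong (⟦*⟧ (suc (suc n)) (suc n !)) (⟦*⟧ (suc (suc n)) (suc n !)) ⟨
    ⟦ suc (suc n) ! ⟧ * ⟦ suc (suc n) ! ⟧ ∎
    where
    N M E : Carrier
    N = ⟦ suc (suc n) ⟧
    M = ⟦ suc n ! ⟧
    E = ⟦ suc n ⟧ * ⟦ suc n ⟧ - N * N
    simplify : ∀ N M E → N * N * (M * M) + E * ((1# + 1#) * 0#) ≈ (N * M) * (N * M)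
    simplify = solve 3 (λ N M E →
      N :* N :* (M :* M) :+ E :* ((con (+ 1) :+ con (+ 1)) :* con (+ 0)) := (N :* M) :* (N :* M)) refl

  two-∑u*H : ∀ n (u : ℕ → Carrier) → (1# + 1#) * ∑ n (λ j → u j * H n j) ≈ u 0 + ⟦ n ! ⟧ * ⟦ n ! ⟧ * u n
  two-∑u*H zero u = begin
    (1# + 1#) * (u 0 * H 0 0)       ≈⟨ *-congˡ (*-congˡ H-zero-zero) ⟩
    (1# + 1#) * (u 0 * 1#)          ≈⟨ simplify (u 0) ⟩
    u 0 + ⟦ 1 ⟧ * ⟦ 1 ⟧ * u 0       ∎
    where
    simplify : ∀ x → (1# + 1#) * (x * 1#) ≈ x + (1# + 0#) * (1# + 0#) * x
    simplify = solve 1 (λ x →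
      (con (+ 1) :+ con (+ 1)) :* (x :* con (+ 1)) := x :+ (con (+ 1) :+ con (+ 0)) :* (con (+ 1) :+ con (+ 0)) :* x) refl
  two-∑u*H (suc n) u = begin
    (1# + 1#) * ∑ (suc n) (λ j → u j * H (suc n) j)
      ≈⟨ *-congˡ (∑-suc n _) ⟩
    (1# + 1#) * (u 0 * H (suc n) 0 + ∑ n (λ j → u (suc j) * H (suc n) (suc j)))
      ≈⟨ *-congˡ (+-congˡ (∑-last n _ (λ j j<n → trans (*-congˡ (H-vanishes j n j<n)) (zeroʳ _)))) ⟩
    (1# + 1#) * (u 0 * H (suc n) 0 + u (suc n) * H (suc n) (suc n))
      ≈⟨ x*[a*y+b*z]≈a*[x*y]+b*[x*z] (1# + 1#) (u 0) (u (suc n)) (H (suc n) 0) (H (suc n) (suc n)) ⟩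
    u 0 * ((1# + 1#) * H (suc n) 0) + u (suc n) * ((1# + 1#) * H (suc n) (suc n))
      ≈⟨ +-cong (*-congˡ (two-H-zeroʳ n)) (*-congˡ (two-H-diagonal n)) ⟩
    u 0 * 1# + u (suc n) * (M * M)
      ≈⟨ simplify (u 0) (u (suc n)) M ⟩
    u 0 + M * M * u (suc n) ∎
    where
    M : Carrier
    M = ⟦ suc n ! ⟧
    simplify : ∀ a b m → a * 1# + b * (m * m) ≈ a + m * m * b
    simplify = solve 3 (λ a b m → a :* con (+ 1) :+ b :* (m :* m) := a :+ m :* m :* b) refl

  ∑ρ*∑q*u≈∑u*H : ∀ n (u : ℕ → Carrier) →
                 ∑ n (λ k → ρ n k * ∑ k (λ j → q k j * u j)) ≈ ∑ n (λ j → u j * H n j)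
  ∑ρ*∑q*u≈∑u*H n u = begin
    ∑ n (λ k → ρ n k * ∑ k (λ j → q k j * u j))
      ≈⟨ ∑-cong n (λ k k≤n → *-congˡ (∑-extend _ (ℕ.≤⇒≤′ k≤n) (λ j k<j →
           trans (*-congʳ (q-vanishes k j k<j)) (zeroˡ _)))) ⟨
    ∑ n (λ k → ρ n k * ∑ n (λ j → q k j * u j))
      ≈⟨ ∑-cong n (λ k _ → *-distribˡ-∑ n (ρ n k) _) ⟩
    ∑ n (λ k → ∑ n (λ j → ρ n k * (q k j * u j)))
      ≈⟨ ∑-comm n n _ ⟩
    ∑ n (λ j → ∑ n (λ k → ρ n k * (q k j * u j)))
      ≈⟨ ∑-cong n (λ j _ →
           trans (∑-cong n (λ k _ → regroup (ρ n k) (q k j) (u j))) (sym (*-distribˡ-∑ n (u j) _))) ⟩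
    ∑ n (λ j → u j * H n j) ∎
    where
    regroup : ∀ r y z → r * (y * z) ≈ z * (r * y)
    regroup = solve 3 (λ r y z → r :* (y :* z) := z :* (r :* y)) refl

  module WithParameters (a b c d x : Carrier) where

    A : ℕ → Carrier
    A k = (a + b) ↑ k * (a + c) ↑ k * (a + d) ↑ k

    u : ℕ → Carrier
    u j = ((a + i * x) ↑ j * (a - i * x) ↑ j) * (⟦ j ! ⟧ * (a + b) ↑ j * (a + c) ↑ j * (a + d) ↑ j) ⁻¹

    summand : ℕ → ℕ → Carrier
    summand n k =
      (- ⟦ n ⟧) ↑ k * ((1# + ⟦ n ⟧) ↑ k * (a + b) ↑ k * (a + c) ↑ k * (a + d) ↑ k) ⁻¹ * W F k x a b c d

    W≈A*∑q*u : a + b + c + d ≈ 1# → ∀ k → W F k x a b c d ≈ A k * ∑ k (λ j → q k j * u j)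
    W≈A*∑q*u a+b+c+d≈1 k = *-congˡ (∑-cong k (λ j _ → begin
      ((- ⟦ k ⟧) ↑ j * (⟦ k ⟧ + a + b + c + d - 1#) ↑ j * X₁ j * X₂ j) * D j ⁻¹
        ≈⟨ *-congʳ (*-congʳ (*-congʳ (*-congˡ (↑-congˡ shift j)))) ⟩
      ((- ⟦ k ⟧) ↑ j * ⟦ k ⟧ ↑ j * X₁ j * X₂ j) * D j ⁻¹
        ≈⟨ regroup ((- ⟦ k ⟧) ↑ j) (⟦ k ⟧ ↑ j) (X₁ j) (X₂ j) (D j ⁻¹) ⟩
      q k j * u j ∎))
      where
      X₁ X₂ D : ℕ → Carrier
      X₁ j = (a + i * x) ↑ j
      X₂ j = (a - i * x) ↑ j
      D j = ⟦ j ! ⟧ * (a + b) ↑ j * (a + c) ↑ j * (a + d) ↑ j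
      shift : ⟦ k ⟧ + a + b + c + d - 1# ≈ ⟦ k ⟧
      shift = begin
        ⟦ k ⟧ + a + b + c + d - 1#
          ≈⟨ solve 5 (λ k a b c d → k :+ a :+ b :+ c :+ d :- con (+ 1) := k :+ (a :+ b :+ c :+ d :- con (+ 1)))
                     refl ⟦ k ⟧ a b c d ⟩
        ⟦ k ⟧ + (a + b + c + d - 1#)     ≈⟨ +-congˡ (+-congʳ a+b+c+d≈1) ⟩
        ⟦ k ⟧ + (1# - 1#)                ≈⟨ +-congˡ (-‿inverseʳ 1#) ⟩
        ⟦ k ⟧ + 0#                       ≈⟨ +-identityʳ ⟦ k ⟧ ⟩
        ⟦ k ⟧                            ∎
      regroup : ∀ p₁ p₂ x₁ x₂ e → (p₁ * p₂ * x₁ * x₂) * e ≈ (p₁ * p₂) * ((x₁ * x₂) * e)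
      regroup = solve 5 (λ p₁ p₂ x₁ x₂ e →
        (p₁ :* p₂ :* x₁ :* x₂) :* e := (p₁ :* p₂) :* ((x₁ :* x₂) :* e)) refl

    module NonDegenerate (a+b+⟦m⟧≉0 : ∀ m → NonZero (a + b + ⟦ m ⟧))
             (a+c+⟦m⟧≉0 : ∀ m → NonZero (a + c + ⟦ m ⟧))
             (a+d+⟦m⟧≉0 : ∀ m → NonZero (a + d + ⟦ m ⟧)) where

      A-nonZero : ∀ k → NonZero (A k)
      A-nonZero k =
        *-nonZero (*-nonZero (↑-nonZero a+b+⟦m⟧≉0 k) (↑-nonZero a+c+⟦m⟧≉0 k)) (↑-nonZero a+d+⟦m⟧≉0 k)

      [y*A]⁻¹≈y⁻¹*A⁻¹ : ∀ {y} k → NonZero y →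
                        (y * (a + b) ↑ k * (a + c) ↑ k * (a + d) ↑ k) ⁻¹ ≈ y ⁻¹ * A k ⁻¹
      [y*A]⁻¹≈y⁻¹*A⁻¹ {y} k y≉0 = begin
        (y * (a + b) ↑ k * (a + c) ↑ k * (a + d) ↑ k) ⁻¹
          ≈⟨ ⁻¹-cong (*-nonZero y≉0 (A-nonZero k)) (regroup y _ _ _) ⟩
        (y * A k) ⁻¹   ≈⟨ ⁻¹-distrib-* y≉0 (A-nonZero k) ⟩
        y ⁻¹ * A k ⁻¹  ∎
        where
        regroup : ∀ y p q r → y * p * q * r ≈ y * (p * q * r)
        regroup = solve 4 (λ y p q r → y :* p :* q :* r := y :* (p :* q :* r)) refl

      summand≈ρ*∑q*u : a + b + c + d ≈ 1# → ∀ n k → summand n k ≈ ρ n k * ∑ k (λ j → q k j * u j)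
      summand≈ρ*∑q*u a+b+c+d≈1 n k = begin
        P * (B * (a + b) ↑ k * (a + c) ↑ k * (a + d) ↑ k) ⁻¹ * W F k x a b c d
          ≈⟨ *-cong (*-congˡ ([y*A]⁻¹≈y⁻¹*A⁻¹ k (↑-nonZero (1+⟦m⟧+⟦n⟧-nonZero n) k)))
                    (W≈A*∑q*u a+b+c+d≈1 k) ⟩
        P * (B ⁻¹ * A k ⁻¹) * (A k * S)   ≈⟨ regroup P (B ⁻¹) (A k) (A k ⁻¹) S ⟩
        P * B ⁻¹ * S * (A k * A k ⁻¹)     ≈⟨ *-congˡ (⁻¹-inverse (A k) (A-nonZero k)) ⟩
        ρ n k * S * 1#                    ≈⟨ *-identityʳ _ ⟩
        ρ n k * S                         ∎
        where
        P B S : Carrier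
        P = (- ⟦ n ⟧) ↑ k
        B = (1# + ⟦ n ⟧) ↑ k
        S = ∑ k (λ j → q k j * u j)
        regroup : ∀ p b y y⁻ s → p * (b * y⁻) * (y * s) ≈ p * b * s * (y * y⁻)
        regroup = solve 5 (λ p b y y⁻ s → p :* (b :* y⁻) :* (y :* s) := p :* b :* s :* (y :* y⁻)) refl

      ∑summand≈∑u*H : a + b + c + d ≈ 1# → ∀ n → ∑ n (summand n) ≈ ∑ n (λ j → u j * H n j)
      ∑summand≈∑u*H a+b+c+d≈1 n =
        trans (∑-cong n (λ k _ → summand≈ρ*∑q*u a+b+c+d≈1 n k)) (∑ρ*∑q*u≈∑u*H n u)

      u-zero : u 0 ≈ 1#
      u-zero = begin
        (1# * 1#) * (⟦ 1 ⟧ * 1# * 1# * 1#) ⁻¹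
          ≈⟨ *-cong (*-identityˡ 1#) ([y*A]⁻¹≈y⁻¹*A⁻¹ 0 (⟦⟧-nonZero 1)) ⟩
        1# * (⟦ 1 ⟧ ⁻¹ * (1# * 1# * 1#) ⁻¹)
          ≈⟨ *-identityˡ _ ⟩
        ⟦ 1 ⟧ ⁻¹ * (1# * 1# * 1#) ⁻¹
          ≈⟨ *-cong (⁻¹-cong 1≉0 (+-identityʳ 1#)) (⁻¹-cong 1≉0 (trans (*-identityʳ _) (*-identityʳ _))) ⟩
        1# ⁻¹ * 1# ⁻¹  ≈⟨ *-cong 1⁻¹≈1 1⁻¹≈1 ⟩
        1# * 1#        ≈⟨ *-identityˡ 1# ⟩
        1#             ∎

      A*[1+n!²u]≈n!*X+A : ∀ n → A n * (1# + ⟦ n ! ⟧ * ⟦ n ! ⟧ * u n)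
                              ≈ ⟦ n ! ⟧ * (a + i * x) ↑ n * (a - i * x) ↑ n + A n
      A*[1+n!²u]≈n!*X+A n = begin
        A n * (1# + M * M * (X * (M * (a + b) ↑ n * (a + c) ↑ n * (a + d) ↑ n) ⁻¹))
          ≈⟨ *-congˡ (+-congˡ (*-congˡ (*-congˡ ([y*A]⁻¹≈y⁻¹*A⁻¹ n M≉0)))) ⟩
        A n * (1# + M * M * (X * (M ⁻¹ * A n ⁻¹)))
          ≈⟨ regroup (A n) M X (M ⁻¹) (A n ⁻¹) ⟩
        M * X * (M * M ⁻¹) * (A n * A n ⁻¹) + A n
          ≈⟨ +-congʳ (*-cong (*-congˡ (⁻¹-inverse M M≉0)) (⁻¹-inverse (A n) (A-nonZero n))) ⟩
        M * X * 1# * 1# + A n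
          ≈⟨ +-congʳ (trans (*-identityʳ _) (trans (*-identityʳ _) (sym (*-assoc M _ _)))) ⟩
        M * (a + i * x) ↑ n * (a - i * x) ↑ n + A n ∎
        where
        M X : Carrier
        M = ⟦ n ! ⟧
        X = (a + i * x) ↑ n * (a - i * x) ↑ n
        M≉0 : NonZero M
        M≉0 = ⟦⟧-nonZero (n !) {{n ℕ.!≢0}}
        regroup : ∀ α m y m⁻ α⁻ → α * (1# + m * m * (y * (m⁻ * α⁻))) ≈ m * y * (m * m⁻) * (α * α⁻) + α
        regroup = solve 5 (λ α m y m⁻ α⁻ →
          α :* (con (+ 1) :+ m :* m :* (y :* (m⁻ :* α⁻))) := m :* y :* (m :* m⁻) :* (α :* α⁻) :+ α) refl

mainTheorem10 : {c ℓ : Level} (F : ComplexLikeField c ℓ) →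
    let open ComplexLikeField F in
    (a b c d x : Carrier) →
    a + b + c + d ≈ 1# →
    (∀ (m : ℕ) → ¬ (a + b + ι F m ≈ 0#)) →
    (∀ (m : ℕ) → ¬ (a + c + ι F m ≈ 0#)) →
    (∀ (m : ℕ) → ¬ (a + d + ι F m ≈ 0#)) →
    (n : ℕ) →
    sumTo F n (λ k →
        poch F (- ι F n) k
          * (poch F (1# + ι F n) k * poch F (a + b) k * poch F (a + c) k * poch F (a + d) k) ⁻¹
          * W F k x a b c d)
      ≈ (ι F (n !) * poch F (a + i * x) n * poch F (a - i * x) n
           + poch F (a + b) n * poch F (a + c) n * poch F (a + d) n)
        * (ι F 2 * (poch F (a + b) n * poch F (a + c) n * poch F (a + d) n)) ⁻¹
mainTheorem10 F a b c d x a+b+c+d≈1 a+b+⟦m⟧≉0 a+c+⟦m⟧≉0 a+d+⟦m⟧≉0 n =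
  x*y≈z⇒y≈z*x⁻¹ (*-nonZero (⟦⟧-nonZero 2) (A-nonZero n)) (begin
    ⟦ 2 ⟧ * A n * L                                   ≈⟨ *-congʳ (*-comm ⟦ 2 ⟧ (A n)) ⟩
    A n * ⟦ 2 ⟧ * L                                   ≈⟨ *-assoc (A n) ⟦ 2 ⟧ L ⟩
    A n * (⟦ 2 ⟧ * L)
      ≈⟨ *-congˡ (*-cong (+-congˡ (+-identityʳ 1#)) (∑summand≈∑u*H a+b+c+d≈1 n)) ⟩
    A n * ((1# + 1#) * ∑ n (λ j → u j * H n j))       ≈⟨ *-congˡ (two-∑u*H n u) ⟩
    A n * (u 0 + ⟦ n ! ⟧ * ⟦ n ! ⟧ * u n)             ≈⟨ *-congˡ (+-congʳ u-zero) ⟩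
    A n * (1# + ⟦ n ! ⟧ * ⟦ n ! ⟧ * u n)              ≈⟨ A*[1+n!²u]≈n!*X+A n ⟩
    ⟦ n ! ⟧ * (a + i * x) ↑ n * (a - i * x) ↑ n + A n ∎)
  where
  open ComplexLikeField F hiding (zero)
  open WilsonSum F
  open import Relation.Binary.Reasoning.Setoid setoid
  open WithParameters a b c d x
  open NonDegenerate a+b+⟦m⟧≉0 a+c+⟦m⟧≉0 a+d+⟦m⟧≉0
  L : Carrier
  L = ∑ n (summand n)
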